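{- Let $(a_1,\dots,a_k)$ be a sequence of nonnegative integers and $1\le \ell\le k$. There is a bijection between $D(a_1,\dots,a_k)$ and $\hat D_\ell(a_1,\dots,a_{\ell-1},a_\ell+1,a_{\ell+1},\dots,a_k)$.
   Context: For a sequence $\mathbf a=(a_1,\dots,a_k)$ of nonnegative integers with sum $n$, put $c_j=a_1+\dots+a_j$ ($c_0=0$) and blocks $A_j=\{c_{j-1}+1,\dots,c_j\}$. $S_{\mathbf a}$ is the set of permutations $\pi$ of $[n]$ with $\pi_i>\pi_{i+1}$ whenever $i,i+1$ lie in the same block. $D(\mathbf a)$ is the set of derangements (permutations with no $i$ such that $\pi_i=i$) in $S_{\mathbf a}$. $\hat D_\ell(\mathbf a)$ is the set of $\pi\in S_{\mathbf a}$ having a fixed point in $A_\ell$ but no fixed points in any other block. -}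

module Defs where

open import Data.Nat using (ℕ; zero; suc; _+_; _<_; _≤ᵇ_)
open import Data.Bool using (Bool; true; false; T)
open import Data.Fin using (Fin; toℕ)
open import Data.Vec using (Vec; lookup; toList)
open import Data.List using (List; []; _∷_; length; filter)
open import Data.Nat.ListAction using (sum)
open import Data.List.Membership.Propositional using (_∈_)
open import Data.List.Relation.Unary.Unique.Propositional using (Unique)
open import Data.Product using (Σ; _×_; _,_; proj₁; ∃)
open import Relation.Binary.PropositionalEquality using (_≡_)
open import Relation.Nullary using (¬_)
open import Data.Nat.Properties using (_≤?_)

-- Positions and values are 0-indexed: position p : Fin n stands for p+1 ∈ [n].

Perm : ℕ → Set
Perm n = Σ (Vec (Fin n) n) (λ v → Unique (toList v))

-- Partial sums c_1, …, c_k of a = (a_1,…,a_k).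
partialSums : List ℕ → List ℕ
partialSums []       = []
partialSums (x ∷ xs) = x ∷ Data.List.map (x +_) (partialSums xs)

-- 0-indexed block of a (0-indexed) position p: the number of j ∈ {1..k} with c_j ≤ p.
-- (So position p lies in block A_{j+1} with j = blockOf a p, i.e. c_j ≤ p < c_{j+1}.)
blockOf : List ℕ → ℕ → ℕ
blockOf a p = length (filter (λ c → c ≤? p) (partialSums a))

InS : (a : List ℕ) → Perm (sum a) → Set
InS a (v , _) = (i : Fin (sum a)) (j : Fin (sum a)) → toℕ j ≡ suc (toℕ i) →
  blockOf a (toℕ i) ≡ blockOf a (toℕ j) → toℕ (lookup v j) < toℕ (lookup v i)

IsFixed : ∀ {n} → Perm n → Fin n → Set
IsFixed (v , _) p = lookup v p ≡ p

D : List ℕ → Set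
D a = Σ (Perm (sum a)) (λ π → InS a π × ((p : Fin (sum a)) → ¬ IsFixed π p))

-- D̂_ℓ(a), ℓ 0-indexed (ℓ = 0 is the block A_1): π ∈ S_a with a fixed point in
-- block A_{ℓ+1} and no fixed point in any other block.
Dhat : ℕ → List ℕ → Set
Dhat ℓ a = Σ (Perm (sum a)) (λ π → InS a π ×
  ((∃ λ p → blockOf a (toℕ p) ≡ ℓ × IsFixed π p) ×
   ((p : Fin (sum a)) → ¬ blockOf a (toℕ p) ≡ ℓ → ¬ IsFixed π p)))

incAt : ℕ → List ℕ → List ℕ
incAt _       []       = []
incAt zero    (x ∷ xs) = suc x ∷ xs
incAt (suc ℓ) (x ∷ xs) = x ∷ incAt ℓ xs

permOf : ∀ {n} {P : Perm n → Set} → Σ (Perm n) P → Vec (Fin n) n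
permOf ((v , _) , _) = v

module Submission where

-- Let σ be a derangement in S_a.  On block A_ℓ, occupying positions [s, e),
-- σ is decreasing, so q ↦ σ(q) - q is strictly decreasing there and never 0:
-- there is a unique crossing point p ∈ [s, e] such that the position before p
-- (if in the block) maps to ≥ p and position p (if in the block) maps below p.
-- Inserting a new fixed point at p (renumbering the other points around p)
-- yields a permutation in S_{a'}, a' = a with a_ℓ + 1, whose fixed points are
-- exactly p, in the grown block.  Conversely a descending run has at most one
-- fixed point, and deleting it from π ∈ D̂_ℓ(a') gives a derangement in S_a
-- whose crossing point is the deleted position, so the two maps are inverse.

open import Defs
open import Data.Nat using (ℕ; zero; suc; pred; _+_; _∸_; _<_; _≤_; z≤n; s≤s; z<s)
open import Data.Nat.Properties
open import Data.Nat.ListAction using (sum)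
open import Data.List using (List; []; _∷_; length; filter; map; take)
import Data.List as List
open import Data.List.Properties using (filter-accept; filter-reject; filter-none; length-map)
open import Data.List.Relation.Unary.All using (universal)
import Data.List.Relation.Unary.All.Properties as ListAll
open import Data.List.Relation.Unary.AllPairs using (_∷_)
open import Data.List.Relation.Unary.Unique.Propositional using (Unique)
open import Data.List.Relation.Unary.Unique.Propositional.Properties using (tabulate⁺)
open import Data.Fin using (Fin; toℕ; fromℕ<; punchIn; punchOut) renaming (zero to fzero; suc to fsuc)
open import Data.Fin.Properties
  using (toℕ-injective; toℕ<n; toℕ-fromℕ<; fromℕ<-toℕ; punchIn-injective; punchInᵢ≢i; punchIn-punchOut;
         punchOut-punchIn; punchOut-cong; punchIn-cancel-≤; punchIn-mono-≤)
  renaming (_≟_ to _≟ᶠ_)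
open import Data.Vec using (Vec; []; _∷_; lookup; tabulate; toList)
open import Data.Vec.Properties using (lookup∘tabulate; tabulate∘lookup; tabulate-cong)
import Data.Vec.Relation.Unary.All.Properties as VecAll
open import Data.Product using (Σ; ∃; _×_; _,_; proj₁; proj₂)
open import Data.Sum using (_⊎_; inj₁; inj₂)
open import Function using (_∘_; _⇔_; mk⇔; Injective; Equivalence)
open import Relation.Binary using (tri<; tri≈; tri>)
open import Relation.Binary.PropositionalEquality
open import Relation.Nullary using (¬_; yes; no; contradiction)

filter-shift : ∀ x r (L : List ℕ) →
  filter (λ c → c ≤? x + r) (map (x +_) L) ≡ map (x +_) (filter (λ c → c ≤? r) L)
filter-shift x r [] = refl
filter-shift x r (c ∷ L) with c ≤? r
... | yes c≤r = begin
    filter P (x + c ∷ map (x +_) L)  ≡⟨ filter-accept P (+-monoʳ-≤ x c≤r) ⟩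
    x + c ∷ filter P (map (x +_) L)  ≡⟨ cong (x + c ∷_) (filter-shift x r L) ⟩
    map (x +_) (c ∷ filter Q L)      ≡⟨ cong (map (x +_)) (filter-accept Q c≤r) ⟨
    map (x +_) (filter Q (c ∷ L))    ∎
  where open ≡-Reasoning; P = λ c → c ≤? x + r; Q = λ c → c ≤? r
... | no c≰r = begin
    filter P (x + c ∷ map (x +_) L)  ≡⟨ filter-reject P (c≰r ∘ +-cancelˡ-≤ x c r) ⟩
    filter P (map (x +_) L)          ≡⟨ filter-shift x r L ⟩
    map (x +_) (filter Q L)          ≡⟨ cong (map (x +_)) (filter-reject Q c≰r) ⟨
    map (x +_) (filter Q (c ∷ L))    ∎
  where open ≡-Reasoning; P = λ c → c ≤? x + r; Q = λ c → c ≤? r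

blockOf-front : ∀ x xs {q} → q < x → blockOf (x ∷ xs) q ≡ 0
blockOf-front x xs {q} q<x =
  begin
    length (filter (λ c → c ≤? q) (x ∷ map (x +_) (partialSums xs)))
  ≡⟨ cong length (filter-reject (λ c → c ≤? q) (<⇒≱ q<x)) ⟩
    length (filter (λ c → c ≤? q) (map (x +_) (partialSums xs)))
  ≡⟨ cong length (filter-none (λ c → c ≤? q) {map (x +_) (partialSums xs)}
                              (ListAll.map⁺ (universal beyond (partialSums xs)))) ⟩
    0
  ∎
  where
  open ≡-Reasoning
  beyond : ∀ c → ¬ x + c ≤ q
  beyond c h = <⇒≱ q<x (≤-trans (m≤m+n x c) h)

blockOf-back : ∀ x xs r → blockOf (x ∷ xs) (x + r) ≡ suc (blockOf xs r)
blockOf-back x xs r =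
  begin
    length (filter (λ c → c ≤? x + r) (x ∷ map (x +_) (partialSums xs)))
  ≡⟨ cong length (filter-accept (λ c → c ≤? x + r) (m≤m+n x r)) ⟩
    suc (length (filter (λ c → c ≤? x + r) (map (x +_) (partialSums xs))))
  ≡⟨ cong (suc ∘ length) (filter-shift x r (partialSums xs)) ⟩
    suc (length (map (x +_) (filter (λ c → c ≤? r) (partialSums xs))))
  ≡⟨ cong suc (length-map (x +_) (filter (λ c → c ≤? r) (partialSums xs))) ⟩
    suc (blockOf xs r)
  ∎
  where open ≡-Reasoning

data Split (x : ℕ) : ℕ → Set where
  front : ∀ {q} → q < x → Split x q
  back  : ∀ r → Split x (x + r)

split : ∀ x q → Split x q
split x q with q <? x
... | yes q<x = front q<x
... | no q≮x  = subst (Split x) (m+[n∸m]≡n (≮⇒≥ q≮x)) (back (q ∸ x))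

-- Block ℓ of a composition with block function B occupies the positions [s, e),
-- and B' is the block function after block ℓ is enlarged by one position:
-- positions before e keep their block, e joins block ℓ, the others move up by one.
record BlockGrowth (n : ℕ) (B B' : ℕ → ℕ) (ℓ s e : ℕ) : Set where
  field
    s≤e       : s ≤ e
    e≤n       : e ≤ n
    before    : ∀ q → q < s → B q < ℓ
    inside    : ∀ q → s ≤ q → q < e → B q ≡ ℓ
    beyond    : ∀ q → e ≤ q → ℓ < B q
    new-end   : B' e ≡ ℓ
    unshifted : ∀ q → q < e → B' q ≡ B q
    shifted   : ∀ q → s ≤ q → B' (suc q) ≡ B q

blockStart : ℕ → List ℕ → ℕ
blockStart ℓ a = sum (take ℓ a)

blockEnd : ℕ → List ℕ → ℕ
blockEnd _       []       = 0
blockEnd zero    (x ∷ _)  = x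
blockEnd (suc ℓ) (x ∷ xs) = x + blockEnd ℓ xs

growth-head : ∀ x xs →
  BlockGrowth (sum (x ∷ xs)) (blockOf (x ∷ xs)) (blockOf (suc x ∷ xs)) 0 0 x
growth-head x xs = record
  { s≤e       = z≤n
  ; e≤n       = m≤m+n x (sum xs)
  ; before    = λ _ ()
  ; inside    = λ q _ q<x → blockOf-front x xs q<x
  ; beyond    = beyond
  ; new-end   = blockOf-front (suc x) xs (n<1+n x)
  ; unshifted = λ q q<x → trans (blockOf-front (suc x) xs (m<n⇒m<1+n q<x))
                                (sym (blockOf-front x xs q<x))
  ; shifted   = shifted
  }
  where
  beyond : ∀ q → x ≤ q → 0 < blockOf (x ∷ xs) q
  beyond q x≤q with split x q
  ... | front q<x = contradiction x≤q (<⇒≱ q<x)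
  ... | back r    = subst (0 <_) (sym (blockOf-back x xs r)) z<s
  shifted : ∀ q → 0 ≤ q → blockOf (suc x ∷ xs) (suc q) ≡ blockOf (x ∷ xs) q
  shifted q _ with split x q
  ... | front q<x = trans (blockOf-front (suc x) xs (s≤s q<x)) (sym (blockOf-front x xs q<x))
  ... | back r    = trans (blockOf-back (suc x) xs r) (sym (blockOf-back x xs r))

growth-cons : ∀ x {xs xs' ℓ s e} →
  BlockGrowth (sum xs) (blockOf xs) (blockOf xs') ℓ s e →
  BlockGrowth (sum (x ∷ xs)) (blockOf (x ∷ xs)) (blockOf (x ∷ xs')) (suc ℓ) (x + s) (x + e)
growth-cons x {xs} {xs'} {ℓ} {s} {e} G = record
  { s≤e       = +-monoʳ-≤ x s≤e
  ; e≤n       = +-monoʳ-≤ x e≤n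
  ; before    = before′
  ; inside    = inside′
  ; beyond    = beyond′
  ; new-end   = trans (blockOf-back x xs' e) (cong suc new-end)
  ; unshifted = unshifted′
  ; shifted   = shifted′
  }
  where
  open BlockGrowth G
  not-front : ∀ {q} t → x + t ≤ q → ¬ q < x
  not-front t h q<x = <⇒≱ q<x (≤-trans (m≤m+n x t) h)

  before′ : ∀ q → q < x + s → blockOf (x ∷ xs) q < suc ℓ
  before′ q q< with split x q
  ... | front q<x = subst (_< suc ℓ) (sym (blockOf-front x xs q<x)) z<s
  ... | back r    = subst (_< suc ℓ) (sym (blockOf-back x xs r))
                          (s≤s (before r (+-cancelˡ-< x r s q<)))

  inside′ : ∀ q → x + s ≤ q → q < x + e → blockOf (x ∷ xs) q ≡ suc ℓ
  inside′ q s≤q q< with split x q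
  ... | front q<x = contradiction q<x (not-front s s≤q)
  ... | back r    = trans (blockOf-back x xs r)
                          (cong suc (inside r (+-cancelˡ-≤ x s r s≤q) (+-cancelˡ-< x r e q<)))

  beyond′ : ∀ q → x + e ≤ q → suc ℓ < blockOf (x ∷ xs) q
  beyond′ q e≤q with split x q
  ... | front q<x = contradiction q<x (not-front e e≤q)
  ... | back r    = subst (suc ℓ <_) (sym (blockOf-back x xs r))
                          (s≤s (beyond r (+-cancelˡ-≤ x e r e≤q)))

  unshifted′ : ∀ q → q < x + e → blockOf (x ∷ xs') q ≡ blockOf (x ∷ xs) q
  unshifted′ q q< with split x q
  ... | front q<x = trans (blockOf-front x xs' q<x) (sym (blockOf-front x xs q<x))
  ... | back r    = begin
    blockOf (x ∷ xs') (x + r)  ≡⟨ blockOf-back x xs' r ⟩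
    suc (blockOf xs' r)        ≡⟨ cong suc (unshifted r (+-cancelˡ-< x r e q<)) ⟩
    suc (blockOf xs r)         ≡⟨ blockOf-back x xs r ⟨
    blockOf (x ∷ xs) (x + r)   ∎
    where open ≡-Reasoning

  shifted′ : ∀ q → x + s ≤ q → blockOf (x ∷ xs') (suc q) ≡ blockOf (x ∷ xs) q
  shifted′ q s≤q with split x q
  ... | front q<x = contradiction q<x (not-front s s≤q)
  ... | back r    = begin
    blockOf (x ∷ xs') (suc (x + r))  ≡⟨ cong (blockOf (x ∷ xs')) (+-suc x r) ⟨
    blockOf (x ∷ xs') (x + suc r)    ≡⟨ blockOf-back x xs' (suc r) ⟩
    suc (blockOf xs' (suc r))        ≡⟨ cong suc (shifted r (+-cancelˡ-≤ x s r s≤q)) ⟩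
    suc (blockOf xs r)               ≡⟨ blockOf-back x xs r ⟨
    blockOf (x ∷ xs) (x + r)         ∎
    where open ≡-Reasoning

blockGrowth : ∀ ℓ a → ℓ < length a →
  BlockGrowth (sum a) (blockOf a) (blockOf (incAt ℓ a)) ℓ (blockStart ℓ a) (blockEnd ℓ a)
blockGrowth zero    (x ∷ xs) _         = growth-head x xs
blockGrowth (suc ℓ) (x ∷ xs) (s≤s ℓ<) = growth-cons x (blockGrowth ℓ xs ℓ<)

sum-incAt : ∀ ℓ a → ℓ < length a → sum (incAt ℓ a) ≡ suc (sum a)
sum-incAt zero    (x ∷ xs) _         = refl
sum-incAt (suc ℓ) (x ∷ xs) (s≤s ℓ<) =
  trans (cong (x +_) (sum-incAt ℓ xs ℓ<)) (+-suc x (sum xs))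

DecreasingOn : (ℕ → ℕ) → ℕ → ℕ → Set
DecreasingOn g lo hi = ∀ q → lo ≤ q → suc q < hi → g (suc q) < g q

decreasing-< : ∀ {g lo hi} → DecreasingOn g lo hi →
  ∀ {p} p' → lo ≤ p → p < p' → p' < hi → g p' < g p
decreasing-< dec {p} (suc r) lo≤p (s≤s p≤r) r<hi with m≤n⇒m<n∨m≡n p≤r
... | inj₂ refl = dec p lo≤p r<hi
... | inj₁ p<r  = <-trans (dec r (≤-trans lo≤p p≤r) r<hi)
                          (decreasing-< dec r lo≤p p<r (<-trans (n<1+n r) r<hi))

decreasing-≤ : ∀ {g lo hi} → DecreasingOn g lo hi →
  ∀ {p p'} → lo ≤ p → p ≤ p' → p' < hi → g p' ≤ g p
decreasing-≤ dec {p' = p'} lo≤p p≤p' p'<hi with m≤n⇒m<n∨m≡n p≤p'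
... | inj₁ p<p' = <⇒≤ (decreasing-< dec p' lo≤p p<p' p'<hi)
... | inj₂ refl = ≤-refl

fixedPoint-unique : ∀ {g lo hi} → DecreasingOn g lo hi → ∀ {p p'} →
  lo ≤ p → lo ≤ p' → p < hi → p' < hi → g p ≡ p → g p' ≡ p' → p ≡ p'
fixedPoint-unique {g} dec {p} {p'} lo≤p lo≤p' p<hi p'<hi gp gp' with <-cmp p p'
... | tri≈ _ p≡p' _ = p≡p'
... | tri< p<p' _ _ =
  contradiction (subst₂ _<_ gp' gp (decreasing-< dec p' lo≤p p<p' p'<hi)) (<-asym p<p')
... | tri> _ _ p'<p =
  contradiction (subst₂ _<_ gp gp' (decreasing-< dec p lo≤p' p'<p p<hi)) (<-asym p'<p)

-- p ∈ [s, e] is a crossing point of g on the run [s, e): the position just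
-- before p (if it is in the run) is mapped to p or beyond, and p itself (if it
-- is in the run) is mapped below p.  This is where a new fixed point p can be
-- inserted into a decreasing run without breaking the descent.
record Crossing (g : ℕ → ℕ) (s e p : ℕ) : Set where
  field
    s≤p   : s ≤ p
    p≤e   : p ≤ e
    left  : p ≡ s ⊎ p ≤ g (pred p)
    right : p ≡ e ⊎ g p < p

crossing-exists : ∀ {g s} e → s ≤ e → (∀ q → s ≤ q → q < e → g q ≢ q) →
  ∃ (Crossing g s e)
crossing-exists {g} {s} e s≤e nofix with s ≟ e
crossing-exists {g} {s} _ s≤e nofix | yes refl =
  s , record { s≤p = ≤-refl ; p≤e = ≤-refl ; left = inj₁ refl ; right = inj₁ refl }
crossing-exists {g} {s} zero    z≤n nofix | no s≢e = contradiction refl s≢e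
crossing-exists {g} {s} (suc e) s≤e nofix | no s≢e
  with crossing-exists e s≤e′ (λ q s≤q q<e → nofix q s≤q (m<n⇒m<1+n q<e))
  where s≤e′ = ≤-pred (≤∧≢⇒< s≤e s≢e)
... | p , c with Crossing.right c
...   | inj₂ gp<p = p , record
  { s≤p   = Crossing.s≤p c
  ; p≤e   = m≤n⇒m≤1+n (Crossing.p≤e c)
  ; left  = Crossing.left c
  ; right = inj₂ gp<p
  }
...   | inj₁ refl with g p <? p
...     | yes gp<p = p , record
  { s≤p   = Crossing.s≤p c
  ; p≤e   = n≤1+n p
  ; left  = Crossing.left c
  ; right = inj₂ gp<p
  }
...     | no gp≮p  = suc p , record
  { s≤p   = m≤n⇒m≤1+n (Crossing.s≤p c)
  ; p≤e   = ≤-refl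
  ; left  = inj₂ (≤∧≢⇒< (≮⇒≥ gp≮p) λ p≡gp → nofix p (Crossing.s≤p c) (n<1+n p) (sym p≡gp))
  ; right = inj₁ refl
  }

-- On a decreasing run two crossing points p < p' are impossible:
-- they would give p' ≤ g (p' - 1) ≤ g p < p.
crossing-ordered : ∀ {g s e} → DecreasingOn g s e →
  ∀ {p p'} → Crossing g s e p → Crossing g s e p' → ¬ p < p'
crossing-ordered dec {p} {suc r} c c' (s≤s p≤r) with Crossing.right c | Crossing.left c'
... | inj₁ refl | _         = <⇒≱ (s≤s p≤r) (Crossing.p≤e c')
... | _         | inj₁ refl = <⇒≱ (s≤s p≤r) (Crossing.s≤p c)
... | inj₂ gp<p | inj₂ r<gr =
  1+n≰n (≤-trans r<gr (≤-trans (decreasing-≤ dec (Crossing.s≤p c) p≤r (Crossing.p≤e c'))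
                                (≤-trans (<⇒≤ gp<p) p≤r)))

crossing-unique : ∀ {g s e} → DecreasingOn g s e →
  ∀ {p p'} → Crossing g s e p → Crossing g s e p' → p ≡ p'
crossing-unique dec {p} {p'} c c' with <-cmp p p'
... | tri≈ _ p≡p' _ = p≡p'
... | tri< p<p' _ _ = contradiction p<p' (crossing-ordered dec c c')
... | tri> _ _ p'<p = contradiction p'<p (crossing-ordered dec c' c)

punchIn-position : ∀ {m} (p : Fin (suc m)) (j : Fin m) →
  (toℕ j < toℕ p × toℕ (punchIn p j) ≡ toℕ j) ⊎
  (toℕ p ≤ toℕ j × toℕ (punchIn p j) ≡ suc (toℕ j))
punchIn-position fzero    j        = inj₂ (z≤n , refl)
punchIn-position (fsuc p) fzero    = inj₁ (z<s , refl)
punchIn-position (fsuc p) (fsuc j) with punchIn-position p j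
... | inj₁ (j<p , eq) = inj₁ (s≤s j<p , cong suc eq)
... | inj₂ (p≤j , eq) = inj₂ (s≤s p≤j , cong suc eq)

punchIn-below : ∀ {m} (p : Fin (suc m)) {j : Fin m} →
  toℕ j < toℕ p → toℕ (punchIn p j) ≡ toℕ j
punchIn-below p {j} j<p with punchIn-position p j
... | inj₁ (_ , eq)   = eq
... | inj₂ (p≤j , _) = contradiction p≤j (<⇒≱ j<p)

punchIn-above : ∀ {m} (p : Fin (suc m)) {j : Fin m} →
  toℕ p ≤ toℕ j → toℕ (punchIn p j) ≡ suc (toℕ j)
punchIn-above p {j} p≤j with punchIn-position p j
... | inj₁ (j<p , _) = contradiction p≤j (<⇒≱ j<p)
... | inj₂ (_ , eq)   = eq

punchIn-<-pivot : ∀ {m} (p : Fin (suc m)) (v : Fin m) →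
  toℕ (punchIn p v) < toℕ p ⇔ toℕ v < toℕ p
punchIn-<-pivot p v with punchIn-position p v
... | inj₁ (v<p , eq) = mk⇔ (λ _ → v<p) (λ _ → subst (_< toℕ p) (sym eq) v<p)
... | inj₂ (p≤v , eq) = mk⇔ (λ h → contradiction (subst (_< toℕ p) eq h) (≤⇒≯ (m≤n⇒m≤1+n p≤v)))
                             (λ v<p → contradiction p≤v (<⇒≱ v<p))

pivot-<-punchIn : ∀ {m} (p : Fin (suc m)) (v : Fin m) →
  toℕ p < toℕ (punchIn p v) ⇔ toℕ p ≤ toℕ v
pivot-<-punchIn p v with punchIn-position p v
... | inj₁ (v<p , eq) = mk⇔ (λ h → contradiction (subst (toℕ p <_) eq h) (<-asym v<p))
                             (λ p≤v → contradiction p≤v (<⇒≱ v<p))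
... | inj₂ (p≤v , eq) = mk⇔ (λ _ → p≤v) (λ _ → subst (toℕ p <_) (sym eq) (s≤s p≤v))

punchIn-mono-< : ∀ {m} (p : Fin (suc m)) {i j : Fin m} →
  toℕ i < toℕ j → toℕ (punchIn p i) < toℕ (punchIn p j)
punchIn-mono-< p {i} {j} i<j = ≰⇒> (λ h → <⇒≱ i<j (punchIn-cancel-≤ p j i h))

punchIn-cancel-< : ∀ {m} (p : Fin (suc m)) {i j : Fin m} →
  toℕ (punchIn p i) < toℕ (punchIn p j) → toℕ i < toℕ j
punchIn-cancel-< p {i} {j} h = ≰⇒> (λ j≤i → <⇒≱ h (punchIn-mono-≤ p j i j≤i))

punchIn-adjacent : ∀ {m} (p : Fin (suc m)) {i j : Fin m} →
  toℕ (punchIn p j) ≡ suc (toℕ (punchIn p i)) → toℕ j ≡ suc (toℕ i)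
punchIn-adjacent p {i} {j} eq with punchIn-position p i | punchIn-position p j
... | inj₁ (_ , ei) | inj₁ (_ , ej) = trans (sym ej) (trans eq (cong suc ei))
... | inj₂ (_ , ei) | inj₂ (_ , ej) = suc-injective (trans (sym ej) (trans eq (cong suc ei)))
... | inj₁ (i<p , ei) | inj₂ (p≤j , ej) = contradiction (subst (toℕ p ≤_) j≡i p≤j) (<⇒≱ i<p)
  where j≡i = suc-injective (trans (sym ej) (trans eq (cong suc ei)))
... | inj₂ (p≤i , ei) | inj₁ (j<p , ej) = contradiction (≤-trans p≤i i≤j) (<⇒≱ j<p)
  where i≤j = subst (toℕ i ≤_) (sym (trans (sym ej) (trans eq (cong suc ei)))) (≤-trans (n≤1+n _) (n≤1+n _))

punchIn-adjacent⁻ : ∀ {m} (p : Fin (suc m)) {i j : Fin m} → toℕ j ≡ suc (toℕ i) →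
  toℕ j ≡ toℕ p ⊎ toℕ (punchIn p j) ≡ suc (toℕ (punchIn p i))
punchIn-adjacent⁻ p {i} {j} j≡1+i with punchIn-position p i | punchIn-position p j
... | inj₁ (_ , ei) | inj₁ (_ , ej) = inj₂ (trans ej (trans j≡1+i (cong suc (sym ei))))
... | inj₂ (_ , ei) | inj₂ (_ , ej) = inj₂ (trans ej (cong suc (trans j≡1+i (sym ei))))
... | inj₁ (i<p , _) | inj₂ (p≤j , _) =
  inj₁ (≤-antisym (subst (_≤ toℕ p) (sym j≡1+i) i<p) p≤j)
... | inj₂ (p≤i , _) | inj₁ (j<p , _) =
  contradiction (≤-trans p≤i (≤-trans (n≤1+n _) (≤-reflexive (sym j≡1+i)))) (<⇒≱ j<p)

punchIn-after-pivot : ∀ {m} (p : Fin (suc m)) {j : Fin m} →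
  toℕ (punchIn p j) ≡ suc (toℕ p) → toℕ j ≡ toℕ p
punchIn-after-pivot p {j} eq with punchIn-position p j
... | inj₁ (j<p , ej) =
  contradiction (subst (_< toℕ p) (trans (sym ej) eq) j<p) (1+n≰n ∘ ≤-trans (n≤1+n _))
... | inj₂ (_ , ej)   = suc-injective (trans (sym ej) eq)

punchIn-before-pivot : ∀ {m} (p : Fin (suc m)) {i : Fin m} →
  toℕ p ≡ suc (toℕ (punchIn p i)) → toℕ p ≡ suc (toℕ i)
punchIn-before-pivot p {i} eq with punchIn-position p i
... | inj₁ (_ , ei)   = trans eq (cong suc ei)
... | inj₂ (p≤i , ei) =
  contradiction (subst (_≤ toℕ i) (trans eq (cong suc ei)) p≤i) (1+n≰n ∘ ≤-trans (n≤1+n _))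

insert : ∀ {m} → Fin (suc m) → (Fin m → Fin m) → Fin (suc m) → Fin (suc m)
insert p σ q with p ≟ᶠ q
... | yes _   = p
... | no p≢q = punchIn p (σ (punchOut p≢q))

insert-pivot : ∀ {m} (p : Fin (suc m)) σ → insert p σ p ≡ p
insert-pivot p σ with p ≟ᶠ p
... | yes _   = refl
... | no p≢p = contradiction refl p≢p

insert-punchIn : ∀ {m} (p : Fin (suc m)) σ j → insert p σ (punchIn p j) ≡ punchIn p (σ j)
insert-punchIn p σ j with p ≟ᶠ punchIn p j
... | yes p≡ = contradiction (sym p≡) (punchInᵢ≢i p j)
... | no p≢  = cong (punchIn p ∘ σ) (trans (punchOut-cong p refl) (punchOut-punchIn p))

data PunchView {m} (p : Fin (suc m)) : Fin (suc m) → Set where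
  pivot   : PunchView p p
  punched : ∀ j → PunchView p (punchIn p j)

punchView : ∀ {m} (p : Fin (suc m)) q → PunchView p q
punchView p q with p ≟ᶠ q
... | yes refl = pivot
... | no p≢q   = subst (PunchView p) (punchIn-punchOut p≢q) (punched (punchOut p≢q))

insert-cong : ∀ {m} (p : Fin (suc m)) {σ τ} → σ ≗ τ → insert p σ ≗ insert p τ
insert-cong p {σ} {τ} σ≗τ q with punchView p q
... | pivot     = trans (insert-pivot p σ) (sym (insert-pivot p τ))
... | punched j = begin
  insert p σ (punchIn p j)  ≡⟨ insert-punchIn p σ j ⟩
  punchIn p (σ j)           ≡⟨ cong (punchIn p) (σ≗τ j) ⟩
  punchIn p (τ j)           ≡⟨ insert-punchIn p τ j ⟨
  insert p τ (punchIn p j)  ∎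
  where open ≡-Reasoning

insert-cancel : ∀ {m} (p : Fin (suc m)) {σ τ} → insert p σ ≗ insert p τ → σ ≗ τ
insert-cancel p {σ} {τ} eq j = punchIn-injective p _ _
  (trans (sym (insert-punchIn p σ j)) (trans (eq (punchIn p j)) (insert-punchIn p τ j)))

-- The pivot is never the image of a punched point, so insertion preserves injectivity.
insert-injective : ∀ {m} (p : Fin (suc m)) {σ} →
  Injective _≡_ _≡_ σ → Injective _≡_ _≡_ (insert p σ)
insert-injective p {σ} σ-inj {x} {y} eq with punchView p x | punchView p y
... | pivot     | pivot     = refl
... | pivot     | punched j = contradiction
  (trans (sym (insert-pivot p σ)) (trans eq (insert-punchIn p σ j))) (punchInᵢ≢i p (σ j) ∘ sym)
... | punched i | pivot     = contradiction
  (trans (sym (insert-punchIn p σ i)) (trans eq (insert-pivot p σ))) (punchInᵢ≢i p (σ i))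
... | punched i | punched j = cong (punchIn p) (σ-inj (punchIn-injective p _ _
  (trans (sym (insert-punchIn p σ i)) (trans eq (insert-punchIn p σ j)))))

insert-injective⁻ : ∀ {m} (p : Fin (suc m)) {σ} →
  Injective _≡_ _≡_ (insert p σ) → Injective _≡_ _≡_ σ
insert-injective⁻ p {σ} inj {i} {j} eq = punchIn-injective p i j
  (inj (trans (insert-punchIn p σ i) (trans (cong (punchIn p) eq) (sym (insert-punchIn p σ j)))))

insert-fixedPoint : ∀ {m} (p : Fin (suc m)) {σ} → (∀ j → σ j ≢ j) →
  ∀ q → insert p σ q ≡ q → q ≡ p
insert-fixedPoint p {σ} der q fixed with punchView p q
... | pivot     = refl
... | punched j =
  contradiction (punchIn-injective p _ _ (trans (sym (insert-punchIn p σ j)) fixed)) (der j)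

remove : ∀ {m} (p : Fin (suc m)) (π : Fin (suc m) → Fin (suc m)) →
  Injective _≡_ _≡_ π → π p ≡ p → ∃ λ σ → insert p σ ≗ π
remove p π π-inj πp≡p = σ , insert-σ
  where
  σ : _ → _
  σ j = punchOut {i = p} {j = π (punchIn p j)}
          (λ p≡ → punchInᵢ≢i p j (π-inj (trans (sym p≡) (sym πp≡p))))
  insert-σ : insert p σ ≗ π
  insert-σ q with punchView p q
  ... | pivot     = trans (insert-pivot p σ) (sym πp≡p)
  ... | punched j = trans (insert-punchIn p σ j) (punchIn-punchOut _)

-- f strictly decreases across every two adjacent positions in the same block of B
-- (this is the condition defining S_a when B = blockOf a).
Descending : ∀ m → (ℕ → ℕ) → (Fin m → Fin m) → Set
Descending m B f =
  (i j : Fin m) → toℕ j ≡ suc (toℕ i) → B (toℕ i) ≡ B (toℕ j) → toℕ (f j) < toℕ (f i)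

descending-≗ : ∀ {m B} {f g : Fin m → Fin m} → f ≗ g → Descending m B f → Descending m B g
descending-≗ f≗g desc i j j≡1+i same =
  subst₂ _<_ (cong toℕ (f≗g j)) (cong toℕ (f≗g i)) (desc i j j≡1+i same)

-- f read on natural-number positions (0 outside the range), to compare positions and values.
onℕ : ∀ {m} → (Fin m → Fin m) → ℕ → ℕ
onℕ {m} f q with q <? m
... | yes q<m = toℕ (f (fromℕ< q<m))
... | no _    = 0

onℕ-at : ∀ {m} (f : Fin m → Fin m) (i : Fin m) {q} → toℕ i ≡ q → onℕ f q ≡ toℕ (f i)
onℕ-at {m} f i refl with toℕ i <? m
... | yes i<m = cong (toℕ ∘ f) (fromℕ<-toℕ i i<m)
... | no i≮m  = contradiction (toℕ<n i) i≮m

descending-run : ∀ {m B} {f : Fin m → Fin m} → Descending m B f → ∀ {lo hi} → hi ≤ m →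
  (∀ q → lo ≤ q → suc q < hi → B q ≡ B (suc q)) → DecreasingOn (onℕ f) lo hi
descending-run {m} {B} {f} desc hi≤m sameBlock q lo≤q q+1<hi =
  subst₂ _<_ (sym (onℕ-at f j tj)) (sym (onℕ-at f i ti))
    (desc i j (trans tj (cong suc (sym ti)))
              (trans (cong B ti) (trans (sameBlock q lo≤q q+1<hi) (cong B (sym tj)))))
  where
  q+1<m = <-≤-trans q+1<hi hi≤m
  i = fromℕ< (<-trans (n<1+n q) q+1<m)
  j = fromℕ< q+1<m
  ti = toℕ-fromℕ< (<-trans (n<1+n q) q+1<m)
  tj = toℕ-fromℕ< q+1<m

perm-injective : ∀ {m} (π : Perm m) → Injective _≡_ _≡_ (lookup (proj₁ π))
perm-injective (v , u) = lookup-injective v u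
  where
  lookup-injective : ∀ {A : Set} {m} (v : Vec A m) → Unique (toList v) → Injective _≡_ _≡_ (lookup v)
  lookup-injective (x ∷ v) (x∉v ∷ u) {fzero}  {fzero}  _  = refl
  lookup-injective (x ∷ v) (x∉v ∷ u) {fzero}  {fsuc j} eq = contradiction eq (x≢ j)
    where x≢ = VecAll.lookup⁺ (VecAll.toList⁻ x∉v)
  lookup-injective (x ∷ v) (x∉v ∷ u) {fsuc i} {fzero}  eq = contradiction (sym eq) (x≢ i)
    where x≢ = VecAll.lookup⁺ (VecAll.toList⁻ x∉v)
  lookup-injective (x ∷ v) (x∉v ∷ u) {fsuc i} {fsuc j} eq = cong fsuc (lookup-injective v u eq)

fromInjection : ∀ {m} (f : Fin m → Fin m) → Injective _≡_ _≡_ f → Perm m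
fromInjection f f-inj = tabulate f , subst Unique (sym (toList-tabulate f)) (tabulate⁺ f-inj)
  where
  toList-tabulate : ∀ {A : Set} {m} (f : Fin m → A) → toList (tabulate f) ≡ List.tabulate f
  toList-tabulate {m = zero}  f = refl
  toList-tabulate {m = suc m} f = cong (f fzero ∷_) (toList-tabulate (f ∘ fsuc))

tabulate-lookup : ∀ {m} {A : Set} {f : Fin m → A} {w : Vec A m} →
  f ≗ lookup w → tabulate f ≡ w
tabulate-lookup {w = w} f≗w = trans (tabulate-cong f≗w) (tabulate∘lookup w)

-- Descending derangements, and descending permutations whose fixed points lie
-- in block ℓ and include at least one (D(a) and D̂_ℓ(a) for B = blockOf a).
Derangements : ℕ → (ℕ → ℕ) → Set
Derangements n B = Σ (Perm n) λ π →
  Descending n B (lookup (proj₁ π)) × ((p : Fin n) → ¬ IsFixed π p)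

FixedOnlyIn : ℕ → (ℕ → ℕ) → ℕ → Set
FixedOnlyIn m B ℓ = Σ (Perm m) λ π → Descending m B (lookup (proj₁ π)) ×
  ((∃ λ p → B (toℕ p) ≡ ℓ × IsFixed π p) × ((p : Fin m) → ¬ B (toℕ p) ≡ ℓ → ¬ IsFixed π p))

PermBijection : ∀ {n m} {P : Perm n → Set} {Q : Perm m → Set} →
  (Σ (Perm n) P → Σ (Perm m) Q) → Set
PermBijection {n} {m} {P} {Q} f =
  ((x y : Σ (Perm n) P) → permOf (f x) ≡ permOf (f y) → permOf x ≡ permOf y) ×
  ((z : Σ (Perm m) Q) → ∃ λ x → permOf (f x) ≡ permOf z)

module GrowBlock {n B B' ℓ s e} (G : BlockGrowth n B B' ℓ s e) where
  open BlockGrowth G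

  grown-block : ∀ {q} → s ≤ q → q ≤ e → B' q ≡ ℓ
  grown-block {q} s≤q q≤e with m≤n⇒m<n∨m≡n q≤e
  ... | inj₁ q<e  = trans (unshifted q q<e) (inside q s≤q q<e)
  ... | inj₂ refl = new-end

  grown-block⁻ : ∀ {q} → B' q ≡ ℓ → s ≤ q × q ≤ e
  grown-block⁻ {q} B'q≡ℓ with q <? s
  ... | yes q<s =
    contradiction (trans (sym (unshifted q (<-≤-trans q<s s≤e))) B'q≡ℓ) (<⇒≢ (before q q<s))
  ... | no q≮s with q ≤? e
  ...   | yes q≤e = ≮⇒≥ q≮s , q≤e
  ...   | no q≰e  = contradiction B'q≡ℓ (after-e q (≰⇒> q≰e))
    where
    after-e : ∀ q → e < q → B' q ≢ ℓ
    after-e (suc r) (s≤s e≤r) B'≡ℓ =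
      <⇒≢ (beyond r e≤r) (sym (trans (sym (shifted r (≤-trans s≤e e≤r))) B'≡ℓ))

  from-start : ∀ {q} → s ≤ q → ℓ ≤ B q
  from-start {q} s≤q with q <? e
  ... | yes q<e = ≤-reflexive (sym (inside q s≤q q<e))
  ... | no q≮e  = <⇒≤ (beyond q (≮⇒≥ q≮e))

  punchIn-block : ∀ (p : Fin (suc n)) → s ≤ toℕ p → toℕ p ≤ e →
    ∀ j → B' (toℕ (punchIn p j)) ≡ B (toℕ j)
  punchIn-block p s≤p p≤e j with punchIn-position p j
  ... | inj₁ (j<p , eq) = trans (cong B' eq) (unshifted _ (<-≤-trans j<p p≤e))
  ... | inj₂ (p≤j , eq) = trans (cong B' eq) (shifted _ (≤-trans s≤p p≤j))

  run-decreasing : ∀ {σ} → Descending n B σ → DecreasingOn (onℕ σ) s e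
  run-decreasing desc = descending-run desc e≤n λ q s≤q q+1<e →
    trans (inside q s≤q (<-trans (n<1+n q) q+1<e))
          (sym (inside (suc q) (m≤n⇒m≤1+n s≤q) q+1<e))

  grown-run-decreasing : ∀ {π} → Descending (suc n) B' π → DecreasingOn (onℕ π) s (suc e)
  grown-run-decreasing desc = descending-run desc (s≤s e≤n) λ q s≤q q+1<e+1 →
    trans (grown-block s≤q (≤-trans (n≤1+n q) (≤-pred q+1<e+1)))
          (sym (grown-block (m≤n⇒m≤1+n s≤q) (≤-pred q+1<e+1)))

  fixed-unique : ∀ {π} → Descending (suc n) B' π → ∀ {u w} →
    B' (toℕ u) ≡ ℓ → B' (toℕ w) ≡ ℓ → π u ≡ u → π w ≡ w → u ≡ w
  fixed-unique {π} desc {u} {w} u∈ℓ w∈ℓ πu≡u πw≡w = toℕ-injective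
    (fixedPoint-unique (grown-run-decreasing desc)
      (proj₁ (grown-block⁻ u∈ℓ)) (proj₁ (grown-block⁻ w∈ℓ))
      (s≤s (proj₂ (grown-block⁻ u∈ℓ))) (s≤s (proj₂ (grown-block⁻ w∈ℓ)))
      (trans (onℕ-at π u refl) (cong toℕ πu≡u)) (trans (onℕ-at π w refl) (cong toℕ πw≡w)))

  crossing-after : ∀ (p : Fin (suc n)) {σ} → Crossing (onℕ σ) s e (toℕ p) →
    ∀ j → toℕ (punchIn p j) ≡ suc (toℕ p) → B' (toℕ (punchIn p j)) ≡ ℓ → toℕ (σ j) < toℕ p
  crossing-after p {σ} c j after inBlock with Crossing.right c
  ... | inj₁ p≡e  =
    contradiction (subst (_≤ e) (trans after (cong suc p≡e)) (proj₂ (grown-block⁻ inBlock))) 1+n≰n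
  ... | inj₂ σp<p = subst (_< toℕ p) (onℕ-at σ j (punchIn-after-pivot p after)) σp<p

  crossing-before : ∀ (p : Fin (suc n)) {σ} → Crossing (onℕ σ) s e (toℕ p) →
    ∀ i → toℕ p ≡ suc (toℕ (punchIn p i)) → B' (toℕ (punchIn p i)) ≡ ℓ → toℕ p ≤ toℕ (σ i)
  crossing-before p {σ} c i before inBlock with Crossing.left c
  ... | inj₁ p≡s  = contradiction
    (subst (_≤ toℕ (punchIn p i)) (trans (sym p≡s) before) (proj₁ (grown-block⁻ inBlock))) 1+n≰n
  ... | inj₂ p≤σ  =
    subst (toℕ p ≤_) (onℕ-at σ i (cong pred (sym (punchIn-before-pivot p before)))) p≤σ

  insert-descending : ∀ (p : Fin (suc n)) {σ} →
    Descending n B σ → Crossing (onℕ σ) s e (toℕ p) → Descending (suc n) B' (insert p σ)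
  insert-descending p {σ} desc c i j j≡1+i same with punchView p i | punchView p j
  ... | pivot | pivot = contradiction j≡1+i (<⇒≢ (n<1+n (toℕ p)))
  ... | pivot | punched j' =
    subst₂ _<_ (sym (cong toℕ (insert-punchIn p σ j'))) (sym (cong toℕ (insert-pivot p σ)))
      (Equivalence.from (punchIn-<-pivot p (σ j'))
        (crossing-after p c j' j≡1+i (trans (sym same) p∈ℓ)))
    where p∈ℓ = grown-block (Crossing.s≤p c) (Crossing.p≤e c)
  ... | punched i' | pivot =
    subst₂ _<_ (sym (cong toℕ (insert-pivot p σ))) (sym (cong toℕ (insert-punchIn p σ i')))
      (Equivalence.from (pivot-<-punchIn p (σ i'))
        (crossing-before p c i' j≡1+i (trans same p∈ℓ)))
    where p∈ℓ = grown-block (Crossing.s≤p c) (Crossing.p≤e c)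
  ... | punched i' | punched j' =
    subst₂ _<_ (sym (cong toℕ (insert-punchIn p σ j'))) (sym (cong toℕ (insert-punchIn p σ i')))
      (punchIn-mono-< p (desc i' j' (punchIn-adjacent p j≡1+i)
        (trans (sym (block i')) (trans same (block j')))))
    where block = punchIn-block p (Crossing.s≤p c) (Crossing.p≤e c)

  value-before-pivot : ∀ (p : Fin (suc n)) {σ} → B' (toℕ p) ≡ ℓ → toℕ p ≢ s →
    Descending (suc n) B' (insert p σ) → toℕ p ≤ onℕ σ (pred (toℕ p))
  value-before-pivot fzero    p∈ℓ p≢s desc =
    contradiction (sym (n≤0⇒n≡0 (proj₁ (grown-block⁻ p∈ℓ)))) p≢s
  value-before-pivot (fsuc i) {σ} p∈ℓ p≢s desc =
    subst (toℕ p ≤_) (sym (onℕ-at σ i refl)) (Equivalence.to (pivot-<-punchIn p (σ i)) p<πi)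
    where
    p    = fsuc i
    πi≡i = punchIn-below p (n<1+n (toℕ i))
    s≤i  = ≤-pred (≤∧≢⇒< (proj₁ (grown-block⁻ p∈ℓ)) (p≢s ∘ sym))
    i∈ℓ  = grown-block s≤i (≤-trans (n≤1+n (toℕ i)) (proj₂ (grown-block⁻ p∈ℓ)))
    p<πi : toℕ p < toℕ (punchIn p (σ i))
    p<πi = subst₂ _<_ (cong toℕ (insert-pivot p σ)) (cong toℕ (insert-punchIn p σ i))
      (desc (punchIn p i) p (cong suc (sym πi≡i)) (trans (cong B' πi≡i) (trans i∈ℓ (sym p∈ℓ))))

  value-at-pivot : ∀ (p : Fin (suc n)) {σ} → B' (toℕ p) ≡ ℓ → toℕ p ≢ e →
    Descending (suc n) B' (insert p σ) → onℕ σ (toℕ p) < toℕ p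
  value-at-pivot p {σ} p∈ℓ p≢e desc =
    subst (_< toℕ p) (sym (onℕ-at σ j tj)) (Equivalence.to (punchIn-<-pivot p (σ j)) πj<p)
    where
    p<e    = ≤∧≢⇒< (proj₂ (grown-block⁻ p∈ℓ)) p≢e
    j      = fromℕ< (<-≤-trans p<e e≤n)
    tj     = toℕ-fromℕ< (<-≤-trans p<e e≤n)
    πj≡1+p = trans (punchIn-above p (≤-reflexive (sym tj))) (cong suc tj)
    πj∈ℓ   = trans (cong B' πj≡1+p) (grown-block (m≤n⇒m≤1+n (proj₁ (grown-block⁻ p∈ℓ))) p<e)
    πj<p : toℕ (punchIn p (σ j)) < toℕ p
    πj<p = subst₂ _<_ (cong toℕ (insert-punchIn p σ j)) (cong toℕ (insert-pivot p σ))
      (desc p (punchIn p j) πj≡1+p (trans p∈ℓ (sym πj∈ℓ)))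

  insert-crossing⁻ : ∀ (p : Fin (suc n)) {σ} →
    B' (toℕ p) ≡ ℓ → Descending (suc n) B' (insert p σ) → Crossing (onℕ σ) s e (toℕ p)
  insert-crossing⁻ p {σ} p∈ℓ desc = record
    { s≤p = proj₁ (grown-block⁻ p∈ℓ) ; p≤e = proj₂ (grown-block⁻ p∈ℓ) ; left = left ; right = right }
    where
    left : toℕ p ≡ s ⊎ toℕ p ≤ onℕ σ (pred (toℕ p))
    left with toℕ p ≟ s
    ... | yes p≡s = inj₁ p≡s
    ... | no p≢s  = inj₂ (value-before-pivot p p∈ℓ p≢s desc)
    right : toℕ p ≡ e ⊎ onℕ σ (toℕ p) < toℕ p
    right with toℕ p ≟ e
    ... | yes p≡e = inj₁ p≡e
    ... | no p≢e  = inj₂ (value-at-pivot p p∈ℓ p≢e desc)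

  -- … and σ is descending.  Adjacent positions i, j of σ stay adjacent in insert p σ,
  -- except when j sits at p: then p separates them, and both lie in block ℓ.
  across-pivot : ∀ (p : Fin (suc n)) {σ} →
    B' (toℕ p) ≡ ℓ → Descending (suc n) B' (insert p σ) →
    ∀ i j → toℕ j ≡ suc (toℕ i) → toℕ j ≡ toℕ p → B (toℕ i) ≡ B (toℕ j) →
    toℕ (insert p σ (punchIn p j)) < toℕ (insert p σ (punchIn p i))
  across-pivot p {σ} p∈ℓ desc i j j≡1+i j≡p same =
    <-trans (desc p (punchIn p j) πj≡1+p (trans p∈ℓ (sym πj∈ℓ)))
            (desc (punchIn p i) p p≡1+πi (trans πi∈ℓ (sym p∈ℓ)))
    where
    s≤p  = proj₁ (grown-block⁻ p∈ℓ)
    p≤e  = proj₂ (grown-block⁻ p∈ℓ)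
    1+i≡p = trans (sym j≡1+i) j≡p
    πi≡i = punchIn-below p (≤-reflexive 1+i≡p)
    p≡1+πi : toℕ p ≡ suc (toℕ (punchIn p i))
    p≡1+πi = trans (sym 1+i≡p) (cong suc (sym πi≡i))
    πj≡1+p : toℕ (punchIn p j) ≡ suc (toℕ p)
    πj≡1+p = trans (punchIn-above p (≤-reflexive (sym j≡p))) (cong suc j≡p)
    -- i lies in block ℓ: otherwise B i < ℓ ≤ B j
    s≤i : s ≤ toℕ i
    s≤i = ≮⇒≥ λ i<s →
      <⇒≱ (before _ i<s) (subst (ℓ ≤_) (sym same) (from-start (subst (s ≤_) (sym j≡p) s≤p)))
    i∈ℓ : B (toℕ i) ≡ ℓ
    i∈ℓ = inside _ s≤i (<-≤-trans (≤-reflexive 1+i≡p) p≤e)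
    block = punchIn-block p s≤p p≤e
    πi∈ℓ = trans (block i) i∈ℓ
    πj∈ℓ = trans (block j) (trans (sym same) i∈ℓ)

  insert-descending⁻ : ∀ (p : Fin (suc n)) {σ} →
    B' (toℕ p) ≡ ℓ → Descending (suc n) B' (insert p σ) → Descending n B σ
  insert-descending⁻ p {σ} p∈ℓ desc i j j≡1+i same =
    punchIn-cancel-< p (subst₂ _<_ (value j) (value i) (images (punchIn-adjacent⁻ p j≡1+i)))
    where
    value : ∀ k → toℕ (insert p σ (punchIn p k)) ≡ toℕ (punchIn p (σ k))
    value k = cong toℕ (insert-punchIn p σ k)
    block = punchIn-block p (proj₁ (grown-block⁻ p∈ℓ)) (proj₂ (grown-block⁻ p∈ℓ))
    images : toℕ j ≡ toℕ p ⊎ toℕ (punchIn p j) ≡ suc (toℕ (punchIn p i)) →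
      toℕ (insert p σ (punchIn p j)) < toℕ (insert p σ (punchIn p i))
    images (inj₁ j≡p) = across-pivot p p∈ℓ desc i j j≡1+i j≡p same
    images (inj₂ adj) = desc (punchIn p i) (punchIn p j) adj (trans (block i) (trans same (sym (block j))))

  insertionPoint : (x : Derangements n B) →
    Σ (Fin (suc n)) λ p → Crossing (onℕ (lookup (permOf x))) s e (toℕ p)
  insertionPoint ((v , _) , _ , der) =
    fromℕ< P<1+n , subst (Crossing (onℕ (lookup v)) s e) (sym (toℕ-fromℕ< P<1+n)) (proj₂ found)
    where
    no-fixed : ∀ q → s ≤ q → q < e → onℕ (lookup v) q ≢ q
    no-fixed q _ q<e eq =
      der k (toℕ-injective (trans (sym (onℕ-at (lookup v) k tk)) (trans eq (sym tk))))
      where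
      k  = fromℕ< (<-≤-trans q<e e≤n)
      tk = toℕ-fromℕ< (<-≤-trans q<e e≤n)
    found = crossing-exists e s≤e no-fixed
    P<1+n : proj₁ found < suc n
    P<1+n = s≤s (≤-trans (Crossing.p≤e (proj₂ found)) e≤n)

  grow : Derangements n B → FixedOnlyIn (suc n) B' ℓ
  grow x@(π@(v , _) , desc , der) =
      fromInjection τ (insert-injective p (perm-injective π))
    , descending-≗ {B = B'} {f = τ} (sym ∘ lookup∘tabulate τ) (insert-descending p desc c)
    , (p , p∈ℓ , trans (lookup∘tabulate τ p) (insert-pivot p (lookup v)))
    , λ q q∉ℓ q-fixed → q∉ℓ (subst (λ q → B' (toℕ q) ≡ ℓ)
        (sym (insert-fixedPoint p der q (trans (sym (lookup∘tabulate τ q)) q-fixed))) p∈ℓ)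
    where
    p   = proj₁ (insertionPoint x)
    c   = proj₂ (insertionPoint x)
    τ   = insert p (lookup v)
    p∈ℓ = grown-block (Crossing.s≤p c) (Crossing.p≤e c)

  -- The inserted point is the only fixed point in block ℓ, so it and σ can be recovered.
  grow-injective : ∀ (x y : Derangements n B) →
    permOf (grow x) ≡ permOf (grow y) → permOf x ≡ permOf y
  grow-injective x@((v , _) , _ , _) y@((w , _) , desc' , _) eq =
    trans (sym (tabulate∘lookup v)) (tabulate-lookup (insert-cancel p σ≗τ))
    where
    p  = proj₁ (insertionPoint x)
    c  = proj₂ (insertionPoint x)
    p' = proj₁ (insertionPoint y)
    c' = proj₂ (insertionPoint y)
    same : insert p (lookup v) ≗ insert p' (lookup w)
    same q = trans (sym (lookup∘tabulate (insert p (lookup v)) q))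
                   (trans (cong (λ t → lookup t q) eq) (lookup∘tabulate (insert p' (lookup w)) q))
    p≡p' : p ≡ p'
    p≡p' = fixed-unique (insert-descending p' desc' c')
      (grown-block (Crossing.s≤p c) (Crossing.p≤e c))
      (grown-block (Crossing.s≤p c') (Crossing.p≤e c'))
      (trans (sym (same p)) (insert-pivot p (lookup v))) (insert-pivot p' (lookup w))
    σ≗τ : insert p (lookup v) ≗ insert p (lookup w)
    σ≗τ q = trans (same q) (cong (λ t → insert t (lookup w) q) (sym p≡p'))

  -- Removing the fixed point q of block ℓ gives a derangement whose insertion point is q.
  grow-surjective : ∀ (z : FixedOnlyIn (suc n) B' ℓ) → ∃ λ x → permOf (grow x) ≡ permOf z
  grow-surjective ((w , u) , desc , (q , q∈ℓ , q-fixed) , fixedOnlyIn) =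
    x , tabulate-lookup (λ r → trans (cong (λ t → insert t σ r) p≡q) (insert≗π r))
    where
    π = lookup w
    removed = remove q π (perm-injective (w , u)) q-fixed
    σ₀ = proj₁ removed
    σ₀-injective : Injective _≡_ _≡_ σ₀
    σ₀-injective = insert-injective⁻ q λ eq →
      perm-injective (w , u) (trans (sym (proj₂ removed _)) (trans eq (proj₂ removed _)))
    σ = lookup (tabulate σ₀)
    insert≗π : insert q σ ≗ π
    insert≗π r = trans (insert-cong q (lookup∘tabulate σ₀) r) (proj₂ removed r)
    desc-insert : Descending (suc n) B' (insert q σ)
    desc-insert = descending-≗ {B = B'} {f = π} (sym ∘ insert≗π) desc
    fixed : ∀ j → σ j ≡ j → π (punchIn q j) ≡ punchIn q j
    fixed j σj≡j =
      trans (sym (insert≗π _)) (trans (insert-punchIn q σ j) (cong (punchIn q) σj≡j))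
    deranged : ∀ j → σ j ≢ j
    deranged j σj≡j with B' (toℕ (punchIn q j)) ≟ ℓ
    ... | yes j∈ℓ = punchInᵢ≢i q j (fixed-unique desc j∈ℓ q∈ℓ (fixed j σj≡j) q-fixed)
    ... | no j∉ℓ  = fixedOnlyIn (punchIn q j) j∉ℓ (fixed j σj≡j)
    σ-descending = insert-descending⁻ q q∈ℓ desc-insert
    x : Derangements n B
    x = fromInjection σ₀ σ₀-injective , σ-descending , deranged
    p≡q : proj₁ (insertionPoint x) ≡ q
    p≡q = toℕ-injective (crossing-unique (run-decreasing σ-descending)
      (proj₂ (insertionPoint x)) (insert-crossing⁻ q q∈ℓ desc-insert))

  fixedPointInsertion : Σ (Derangements n B → FixedOnlyIn (suc n) B' ℓ) PermBijection
  fixedPointInsertion = grow , grow-injective , grow-surjective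

lemma3 : (a : List ℕ) (ℓ : ℕ) → ℓ < length a →
    Σ (D a → Dhat ℓ (incAt ℓ a)) λ f →
      ((x y : D a) → permOf (f x) ≡ permOf (f y) → permOf x ≡ permOf y) ×
      ((z : Dhat ℓ (incAt ℓ a)) → ∃ λ x → permOf (f x) ≡ permOf z)
lemma3 a ℓ ℓ<k =
  subst (λ m → Σ (D a → FixedOnlyIn m (blockOf (incAt ℓ a)) ℓ) PermBijection)
        (sym (sum-incAt ℓ a ℓ<k))
        (GrowBlock.fixedPointInsertion (blockGrowth ℓ a ℓ<k))
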